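{- Let $P$ be a $\mathbb{Z}_2$-crown and $f: P \rightarrow Q_1$ a $\mathbb{Z}_2$-map. Then $\hat{f}(\mathrm{soi}(P)) = \mathrm{soi}(Q_1)$.
   Context: A $\mathbb{Z}_2$-poset is a poset with a fixed-point-free order-automorphism $x\mapsto -x$ of order 2; a $\mathbb{Z}_2$-map between $\mathbb{Z}_2$-posets is an order-preserving map $f$ with $f(-x)=-f(x)$. A $\mathbb{Z}_2$-crown is a $\mathbb{Z}_2$-poset with elements $\pm0,\pm1,\dots,\pm(2n-1)$ (some $n\ge1$), involution $i\mapsto -i$, whose only strict relations are $0<1>2<3>\cdots<2n-1>-0<-1>-2<-3>\cdots<-(2n-1)>0$. $Q_1$ is the $\mathbb{Z}_2$-poset with elements $+0,-0,+1,-1$, where each of $+0,-0$ is below each of $+1,-1$ (and no other strict relations), with involution $\pm i\mapsto \mp i$. For a poset $P$, let $\mathbb{Z}_2^{P^{\underline{2}}}$ be the $\mathbb{Z}_2$-vector space with basis the set of comparable pairs $(x\le y)$ of $P$ (including $x=y$). An order-preserving map $f:P\to Q$ induces the linear map $\hat f:\mathbb{Z}_2^{P^{\underline{2}}}\to\mathbb{Z}_2^{Q^{\underline{2}}}$ sending $(x\le y)$ to $(f(x)\le f(y))$. The strict order indicator $\mathrm{soi}(P)$ is the sum of all basis elements $(x\le y)$ with $x< y$. -}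

module Defs where

open import Data.Bool using (Bool; true; false; not; _∧_; _∨_; _xor_; T; if_then_else_)
open import Data.Nat using (ℕ; zero; suc; _*_; _%_; _≡ᵇ_)
open import Data.Fin using (Fin; toℕ)
open import Data.Product using (_×_; _,_; proj₁; proj₂)
open import Data.List using (List; allFin; cartesianProduct; foldr)
open import Relation.Binary.PropositionalEquality using (_≡_)
open import Relation.Nullary using (does)
open import Relation.Nullary.Decidable using (⌊_⌋)
open import Relation.Binary using (DecidableEquality)
import Data.Bool.Properties as BoolP
import Data.Fin.Properties as FinP
import Data.Product.Properties as ProdP
open import Data.List using (map)

record FinZ2Poset : Set₁ where
  field
    Carrier : Set
    elems   : List Carrier          -- enumeration of all elements (each once)
    _≟_     : DecidableEquality Carrier
    _≤ᵇ_    : Carrier → Carrier → Bool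
    neg     : Carrier → Carrier

  _<ᵇ_ : Carrier → Carrier → Bool
  x <ᵇ y = (x ≤ᵇ y) ∧ not (does (x ≟ y))

open FinZ2Poset public

record IsZ2Map (P Q : FinZ2Poset) (f : Carrier P → Carrier Q) : Set where
  field
    monotone : ∀ x y → T (_≤ᵇ_ P x y) → T (_≤ᵇ_ Q (f x) (f y))
    equivar  : ∀ x → f (neg P x) ≡ neg Q (f x)

-- Elements ±i, i ∈ Fin m, represented as (sign , i) with sign true = +.

SignedFin : ℕ → Set
SignedFin m = Bool × Fin m

_≟±_ : ∀ {m} → DecidableEquality (SignedFin m)
_≟±_ = ProdP.≡-dec BoolP._≟_ FinP._≟_

allSigned : ∀ m → List (SignedFin m)
allSigned m = cartesianProduct (true Data.List.∷ false Data.List.∷ Data.List.[]) (allFin m)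

negSigned : ∀ {m} → SignedFin m → SignedFin m
negSigned (s , i) = (not s , i)

-- Z2-crown with elements ±0,…,±(2n-1): the only strict relations are
--   0 < 1 > 2 < 3 > ⋯ < 2n-1 > -0 < -1 > -2 < ⋯ < -(2n-1) > 0,
-- i.e. ±i < ±j (same sign) iff i is even and j = i ± 1,
-- and ±0 < ∓(2n-1).
crownLt : (n : ℕ) → SignedFin (2 * n) → SignedFin (2 * n) → Bool
crownLt n (s , i) (t , j) =
     (does (BoolP._≟_ s t) ∧ ((toℕ i % 2) ≡ᵇ 0)
        ∧ ((toℕ j ≡ᵇ suc (toℕ i)) ∨ (suc (toℕ j) ≡ᵇ toℕ i)))
  ∨ (does (BoolP._≟_ t (not s)) ∧ (toℕ i ≡ᵇ 0) ∧ (suc (toℕ j) ≡ᵇ 2 * n))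

crown : ℕ → FinZ2Poset
crown n = record
  { Carrier = SignedFin (2 * n)
  ; elems   = allSigned (2 * n)
  ; _≟_     = _≟±_
  ; _≤ᵇ_    = λ x y → does (x ≟± y) ∨ crownLt n x y
  ; neg     = negSigned
  }

-- Q₁: elements ±0, ±1 with ±0 < ±1 (all four relations) only.
Q₁ : FinZ2Poset
Q₁ = record
  { Carrier = SignedFin 2
  ; elems   = allSigned 2
  ; _≟_     = _≟±_
  ; _≤ᵇ_    = λ x y → does (x ≟± y) ∨ ((toℕ (proj₂ x) ≡ᵇ 0) ∧ (toℕ (proj₂ y) ≡ᵇ 1))
  ; neg     = negSigned
  }

-- The Z2-vector space Z2^{P^2}: a vector is given by its coefficient
-- (in Bool = Z2) at each basis element (x ≤ y); only the values at
-- comparable pairs x ≤ y are meaningful.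

Vec₂ : FinZ2Poset → Set
Vec₂ P = Carrier P → Carrier P → Bool

Σ₂ : ∀ {A : Set} → List A → (A → Bool) → Bool
Σ₂ xs g = foldr (λ a acc → g a xor acc) false xs

-- induced linear map f̂ : (x ≤ y) ↦ (f x ≤ f y); the coefficient of
-- (a ≤ b) in f̂ v is the Z2-sum of v(x,y) over comparable (x ≤ y) with
-- f x = a and f y = b.
hat : (P Q : FinZ2Poset) → (Carrier P → Carrier Q) → Vec₂ P → Vec₂ Q
hat P Q f v a b =
  Σ₂ (elems P) λ x → Σ₂ (elems P) λ y →
    _≤ᵇ_ P x y ∧ does (_≟_ Q (f x) a) ∧ does (_≟_ Q (f y) b) ∧ v x y

soi : (P : FinZ2Poset) → Vec₂ P
soi P x y = _<ᵇ_ P x y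

_≈₂_ : {P : FinZ2Poset} → Vec₂ P → Vec₂ P → Set
_≈₂_ {P} v w = ∀ a b → T (_≤ᵇ_ P a b) → v a b ≡ w a b

-- The strict relations of the crown come in antipodal pairs {x < y, -x < -y}, so by
-- equivariance the coefficient of (a ≤ b) in f̂(soi P) is a sum, over the strict relations
-- x < y with x positive, of [f x = a][f y = b] + [-f x = a][-f y = b]. On the comparable
-- pairs p ≤ q of Q₁ this summand is a coboundary α(p) + β(q). Every positive element lies
-- below an even number of elements, and every element other than ±(2n-1) lies above an even
-- number of positive elements, so the sum collapses to β(f(2n-1)) + β(-f(2n-1)); a finite
-- check on Q₁ shows that this is the coefficient of (a ≤ b) in soi(Q₁).
module Submission where

open import Defs hiding (_<ᵇ_)
open import Algebra.Bundles using (CommutativeRing)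
open import Data.Bool using (Bool; true; false; not; _∧_; _∨_; _xor_; T; if_then_else_)
open import Data.Bool.Properties as Bool
  using ( xor-comm; xor-identityʳ; xor-same; xor-∧-commutativeRing
        ; ∧-distribˡ-xor; ∧-distribʳ-xor; ∧-identityʳ; ∧-zeroʳ; ∨-identityʳ; T-≡; T-∨; T? )
open import Data.Fin using (Fin; toℕ; fromℕ)
import Data.Fin as Fin
open import Data.Fin.Properties using (all?; toℕ<n)
open import Data.List using (List; []; _∷_; _++_; map; allFin)
open import Data.List.Properties using (map-tabulate; ++-identityʳ)
open import Data.Nat using (ℕ; zero; suc; pred; _*_; _<_; _≤_; _≥_; _%_; _≡ᵇ_; _<ᵇ_; z<s; s<s)
open import Data.Nat.DivMod using (m*n%n≡0)
open import Data.Nat.Properties using (*-comm; <⇒<ᵇ; <⇒≤; ≤-refl)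
open import Data.Product using (_,_; proj₁; proj₂)
open import Data.Sum using (inj₂)
open import Function using (_∘_; id; Equivalence)
open import Relation.Binary.PropositionalEquality
  using (_≡_; refl; sym; trans; cong; cong₂; module ≡-Reasoning)
open import Relation.Nullary using (Dec; does; yes; no; _×-dec_; _→-dec_)
open import Relation.Nullary.Decidable using (map′; from-yes)
open import Relation.Unary using (Decidable)

open import Algebra.Properties.CommutativeSemigroup
  (CommutativeRing.+-commutativeSemigroup xor-∧-commutativeRing) using (interchange)
open Equivalence using (to; from)
open ≡-Reasoning

module _ {A : Set} where

  Σ₂-cong : (xs : List A) {g h : A → Bool} → (∀ x → g x ≡ h x) → Σ₂ xs g ≡ Σ₂ xs h
  Σ₂-cong []       _  = refl
  Σ₂-cong (x ∷ xs) eq = cong₂ _xor_ (eq x) (Σ₂-cong xs eq)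

  Σ₂-false : (xs : List A) → Σ₂ xs (λ _ → false) ≡ false
  Σ₂-false []       = refl
  Σ₂-false (_ ∷ xs) = Σ₂-false xs

  Σ₂-xor : (xs : List A) (g h : A → Bool) →
           Σ₂ xs (λ x → g x xor h x) ≡ Σ₂ xs g xor Σ₂ xs h
  Σ₂-xor []       g h = refl
  Σ₂-xor (x ∷ xs) g h =
    trans (cong ((g x xor h x) xor_) (Σ₂-xor xs g h)) (interchange (g x) (h x) _ _)

  Σ₂-∧ˡ : (xs : List A) (c : Bool) (g : A → Bool) → Σ₂ xs (λ x → c ∧ g x) ≡ c ∧ Σ₂ xs g
  Σ₂-∧ˡ []       false g = refl
  Σ₂-∧ˡ []       true  g = refl
  Σ₂-∧ˡ (x ∷ xs) c     g =
    trans (cong ((c ∧ g x) xor_) (Σ₂-∧ˡ xs c g)) (sym (∧-distribˡ-xor c (g x) _))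

  Σ₂-∧ʳ : (xs : List A) (g : A → Bool) (c : Bool) → Σ₂ xs (λ x → g x ∧ c) ≡ Σ₂ xs g ∧ c
  Σ₂-∧ʳ []       g c = refl
  Σ₂-∧ʳ (x ∷ xs) g c =
    trans (cong ((g x ∧ c) xor_) (Σ₂-∧ʳ xs g c)) (sym (∧-distribʳ-xor c (g x) _))

  Σ₂-∧-xor : (xs : List A) (c g h : A → Bool) →
    Σ₂ xs (λ x → c x ∧ (g x xor h x)) ≡ Σ₂ xs (λ x → c x ∧ g x) xor Σ₂ xs (λ x → c x ∧ h x)
  Σ₂-∧-xor xs c g h =
    trans (Σ₂-cong xs (λ x → ∧-distribˡ-xor (c x) (g x) (h x)))
          (Σ₂-xor xs (λ x → c x ∧ g x) (λ x → c x ∧ h x))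

  Σ₂-++ : (xs ys : List A) (g : A → Bool) → Σ₂ (xs ++ ys) g ≡ Σ₂ xs g xor Σ₂ ys g
  Σ₂-++ []       ys g = refl
  Σ₂-++ (x ∷ xs) ys g =
    trans (cong (g x xor_) (Σ₂-++ xs ys g)) (sym (Bool.xor-assoc (g x) _ _))

  Σ₂-map : {B : Set} (h : B → A) (xs : List B) (g : A → Bool) →
           Σ₂ (map h xs) g ≡ Σ₂ xs (g ∘ h)
  Σ₂-map h []       g = refl
  Σ₂-map h (x ∷ xs) g = cong (g (h x) xor_) (Σ₂-map h xs g)

Σ₂-comm : {A B : Set} (xs : List A) (ys : List B) (g : A → B → Bool) →
          Σ₂ xs (λ x → Σ₂ ys (g x)) ≡ Σ₂ ys (λ y → Σ₂ xs (λ x → g x y))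
Σ₂-comm []       ys g = sym (Σ₂-false ys)
Σ₂-comm (x ∷ xs) ys g =
  trans (cong (Σ₂ ys (g x) xor_) (Σ₂-comm xs ys g)) (sym (Σ₂-xor ys (g x) _))

∧-congˡ-T : ∀ c {x y} → (T c → x ≡ y) → c ∧ x ≡ c ∧ y
∧-congˡ-T false _  = refl
∧-congˡ-T true  eq = eq _

∨-disjoint : ∀ x y → x ∧ y ≡ false → x ∨ y ≡ x xor y
∨-disjoint false y     _ = refl
∨-disjoint true  false _ = refl

Σ₂-allFin-suc : ∀ m (g : Fin (suc m) → Bool) →
                Σ₂ (allFin (suc m)) g ≡ g Fin.zero xor Σ₂ (allFin m) (g ∘ Fin.suc)
Σ₂-allFin-suc m g =
  cong (g Fin.zero xor_)
    (trans (cong (λ xs → Σ₂ xs g) (sym (map-tabulate id Fin.suc))) (Σ₂-map Fin.suc (allFin m) g))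

Σ₂-allFin-≡ᵇ : ∀ m c → Σ₂ (allFin m) (λ j → toℕ j ≡ᵇ c) ≡ (c <ᵇ m)
Σ₂-allFin-≡ᵇ zero    c       = refl
Σ₂-allFin-≡ᵇ (suc m) zero    =
  trans (Σ₂-allFin-suc m (λ j → toℕ j ≡ᵇ 0)) (cong (true xor_) (Σ₂-false (allFin m)))
Σ₂-allFin-≡ᵇ (suc m) (suc c) =
  trans (Σ₂-allFin-suc m (λ j → toℕ j ≡ᵇ suc c)) (Σ₂-allFin-≡ᵇ m c)

Σ₂-allFin-suc≡ᵇ : ∀ m c → c ≤ m → Σ₂ (allFin m) (λ j → suc (toℕ j) ≡ᵇ c) ≡ (0 <ᵇ c)
Σ₂-allFin-suc≡ᵇ m zero    _   = Σ₂-false (allFin m)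
Σ₂-allFin-suc≡ᵇ m (suc c) c<m = trans (Σ₂-allFin-≡ᵇ m c) (to T-≡ (<⇒<ᵇ c<m))

Σ₂-allFin-≡ᵇ-∧ : ∀ m c (h : ℕ → Bool) →
                 Σ₂ (allFin m) (λ i → (c ≡ᵇ toℕ i) ∧ h (toℕ i)) ≡ (c <ᵇ m) ∧ h c
Σ₂-allFin-≡ᵇ-∧ zero    c       h = refl
Σ₂-allFin-≡ᵇ-∧ (suc m) zero    h =
  trans (Σ₂-allFin-suc m (λ i → (0 ≡ᵇ toℕ i) ∧ h (toℕ i)))
        (trans (cong (h 0 xor_) (Σ₂-false (allFin m))) (xor-identityʳ (h 0)))
Σ₂-allFin-≡ᵇ-∧ (suc m) (suc c) h =
  trans (Σ₂-allFin-suc m (λ i → (suc c ≡ᵇ toℕ i) ∧ h (toℕ i))) (Σ₂-allFin-≡ᵇ-∧ m c (h ∘ suc))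

Σ₂-allFin-pred : ∀ m c (h : ℕ → Bool) → c ≤ m →
                 Σ₂ (allFin m) (λ i → (c ≡ᵇ suc (toℕ i)) ∧ h (toℕ i)) ≡ (0 <ᵇ c) ∧ h (pred c)
Σ₂-allFin-pred m zero    h _   = Σ₂-false (allFin m)
Σ₂-allFin-pred m (suc c) h c<m =
  trans (Σ₂-allFin-≡ᵇ-∧ m c h) (cong (_∧ h c) (to T-≡ (<⇒<ᵇ c<m)))

Σ₂-allFin-last : ∀ m (h : Fin (suc m) → Bool) →
                 Σ₂ (allFin (suc m)) (λ j → (toℕ j ≡ᵇ m) ∧ h j) ≡ h (fromℕ m)
Σ₂-allFin-last zero    h = xor-identityʳ (h Fin.zero)
Σ₂-allFin-last (suc m) h =
  trans (Σ₂-allFin-suc (suc m) (λ j → (toℕ j ≡ᵇ suc m) ∧ h j)) (Σ₂-allFin-last m (h ∘ Fin.suc))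

Σ₂-allSigned : ∀ m (g : SignedFin m → Bool) →
  Σ₂ (allSigned m) g ≡ Σ₂ (allFin m) (λ i → g (true , i)) xor Σ₂ (allFin m) (λ i → g (false , i))
Σ₂-allSigned m g =
  trans (Σ₂-++ (map (true ,_) (allFin m)) _ g)
    (cong₂ _xor_ (Σ₂-map (true ,_) (allFin m) g)
      (trans (cong (λ xs → Σ₂ xs g) (++-identityʳ (map (false ,_) (allFin m))))
             (Σ₂-map (false ,_) (allFin m) g)))

Σ₂-allSigned-neg : ∀ m (g : SignedFin m → Bool) →
                   Σ₂ (allSigned m) (g ∘ negSigned) ≡ Σ₂ (allSigned m) g
Σ₂-allSigned-neg m g =
  trans (Σ₂-allSigned m (g ∘ negSigned))
    (trans (xor-comm (Σ₂ (allFin m) (λ i → g (false , i))) (Σ₂ (allFin m) (λ i → g (true , i))))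
           (sym (Σ₂-allSigned m g)))

Σ₂-allSigned-fold : ∀ m (r w : SignedFin m → SignedFin m → Bool) →
  (∀ x y → r (negSigned x) (negSigned y) ≡ r x y) →
  Σ₂ (allSigned m) (λ x → Σ₂ (allSigned m) (λ y → r x y ∧ w x y)) ≡
  Σ₂ (allFin m) (λ i → Σ₂ (allSigned m) (λ y →
    r (true , i) y ∧ (w (true , i) y xor w (false , i) (negSigned y))))
Σ₂-allSigned-fold m r w r-neg = begin
  Σ₂ (allSigned m) R
    ≡⟨ Σ₂-allSigned m R ⟩
  Σ₂ (allFin m) (λ i → R (true , i)) xor Σ₂ (allFin m) (λ i → R (false , i))
    ≡⟨ sym (Σ₂-xor (allFin m) (λ i → R (true , i)) (λ i → R (false , i))) ⟩
  Σ₂ (allFin m) (λ i → R (true , i) xor R (false , i))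
    ≡⟨ Σ₂-cong (allFin m) (λ i → trans (cong (R (true , i) xor_) (R-neg i)) (merge i)) ⟩
  Σ₂ (allFin m) (λ i → Σ₂ (allSigned m) (λ y →
    r (true , i) y ∧ (w (true , i) y xor w (false , i) (negSigned y))))
    ∎
  where
  R : SignedFin m → Bool
  R x = Σ₂ (allSigned m) (λ y → r x y ∧ w x y)

  w⁻ : Fin m → SignedFin m → Bool
  w⁻ i y = w (false , i) (negSigned y)

  R-neg : ∀ i → R (false , i) ≡ Σ₂ (allSigned m) (λ y → r (true , i) y ∧ w⁻ i y)
  R-neg i = trans (sym (Σ₂-allSigned-neg m (λ y → r (false , i) y ∧ w (false , i) y)))
                  (Σ₂-cong (allSigned m) (λ y → cong (_∧ w⁻ i y) (r-neg (true , i) y)))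

  merge : ∀ i → R (true , i) xor Σ₂ (allSigned m) (λ y → r (true , i) y ∧ w⁻ i y) ≡
                Σ₂ (allSigned m) (λ y → r (true , i) y ∧ (w (true , i) y xor w⁻ i y))
  merge i = sym (Σ₂-∧-xor (allSigned m) (r (true , i)) (w (true , i)) (w⁻ i))

hat-soi : ∀ P Q (f : Carrier P → Carrier Q) a b →
  hat P Q f (soi P) a b ≡
  Σ₂ (elems P) (λ x → Σ₂ (elems P) (λ y → soi P x y ∧ does (_≟_ Q (f x) a) ∧ does (_≟_ Q (f y) b)))
hat-soi P Q f a b =
  Σ₂-cong (elems P) (λ x → Σ₂-cong (elems P) (λ y →
    strict-absorbs (_≤ᵇ_ P x y) (not (does (_≟_ P x y)))
                   (does (_≟_ Q (f x) a)) (does (_≟_ Q (f y) b))))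
  where
  strict-absorbs : ∀ l e u v → l ∧ u ∧ v ∧ (l ∧ e) ≡ (l ∧ e) ∧ u ∧ v
  strict-absorbs false e u v = refl
  strict-absorbs true  e u v = trans (sym (Bool.∧-assoc u v e)) (Bool.∧-comm (u ∧ v) e)

even : ℕ → Bool
even k = (k % 2) ≡ᵇ 0

even-2* : ∀ n → T (even (2 * n))
even-2* n = from T-≡ (cong (_≡ᵇ 0) (trans (cong (_% 2) (*-comm 2 n)) (m*n%n≡0 n 2)))

even-suc< : ∀ {m} i → T (even m) → T (even i) → i < m → suc i < m
even-suc< {suc (suc m)} zero          _  _  _                   = s<s z<s
even-suc< {suc (suc m)} (suc (suc i)) em ei (s<s (s<s i<m)) = s<s (s<s (even-suc< i em ei i<m))
even-suc< {suc zero}    zero          () _  _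
even-suc< {suc zero}    (suc (suc i)) _  _  (s<s ())

even-neighbours : ∀ {m} k → T (even m) → k < m →
                  ((suc k <ᵇ m) xor (0 <ᵇ k)) ∧ even k ≡ (k ≡ᵇ 0)
even-neighbours zero em k<m rewrite to T-≡ (<⇒<ᵇ (even-suc< zero em _ k<m)) = refl
even-neighbours (suc k) em k<m with even (suc k) in ek
... | false = ∧-zeroʳ _
... | true rewrite to T-≡ (<⇒<ᵇ (even-suc< (suc k) em (from T-≡ ek) k<m)) = refl

odd-neighbours : ∀ {m} j → T (even m) → j < m →
                 ((0 <ᵇ j) ∧ even (pred j)) xor ((suc j <ᵇ m) ∧ even (suc j)) ≡ (suc j ≡ᵇ m)
odd-neighbours {suc (suc m)}       zero                _  _ = refl
odd-neighbours {suc (suc zero)}    (suc zero)          _  _ = refl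
odd-neighbours {suc (suc (suc m))} (suc zero)          _  _ = refl
odd-neighbours {suc (suc m)}       (suc (suc zero))    em (s<s (s<s j<m)) =
  odd-neighbours zero em j<m
odd-neighbours {suc (suc m)}       (suc (suc (suc j))) em (s<s (s<s j<m)) =
  odd-neighbours (suc j) em j<m
odd-neighbours {suc zero}          zero                () _

≡ᵇ-suc-exclusive : ∀ i j → (j ≡ᵇ suc i) ∧ (suc j ≡ᵇ i) ≡ false
≡ᵇ-suc-exclusive zero    j       = ∧-zeroʳ _
≡ᵇ-suc-exclusive (suc i) zero    = refl
≡ᵇ-suc-exclusive (suc i) (suc j) = ≡ᵇ-suc-exclusive i j

≡ᵇ-suc-irreflˡ : ∀ k → (k ≡ᵇ suc k) ≡ false
≡ᵇ-suc-irreflˡ zero    = refl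
≡ᵇ-suc-irreflˡ (suc k) = ≡ᵇ-suc-irreflˡ k

≡ᵇ-suc-irreflʳ : ∀ k → (suc k ≡ᵇ k) ≡ false
≡ᵇ-suc-irreflʳ zero    = refl
≡ᵇ-suc-irreflʳ (suc k) = ≡ᵇ-suc-irreflʳ k

crownLt-same : ∀ n s (i j : Fin (2 * n)) → crownLt n (s , i) (s , j) ≡
  ((toℕ j ≡ᵇ suc (toℕ i)) xor (suc (toℕ j) ≡ᵇ toℕ i)) ∧ even (toℕ i)
crownLt-same n s i j = begin
  crownLt n (s , i) (s , j)  ≡⟨ no-antipodal-edge s ⟩
  even k ∧ (up ∨ down)       ≡⟨ cong (even k ∧_) (∨-disjoint up down (≡ᵇ-suc-exclusive k (toℕ j))) ⟩
  even k ∧ (up xor down)     ≡⟨ Bool.∧-comm (even k) (up xor down) ⟩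
  (up xor down) ∧ even k     ∎
  where
  k : ℕ
  k = toℕ i
  up down : Bool
  up = toℕ j ≡ᵇ suc k
  down = suc (toℕ j) ≡ᵇ k

  no-antipodal-edge : ∀ s → crownLt n (s , i) (s , j) ≡ even k ∧ (up ∨ down)
  no-antipodal-edge true  = ∨-identityʳ _
  no-antipodal-edge false = ∨-identityʳ _

crownLt-irrefl : ∀ n x → crownLt n x x ≡ false
crownLt-irrefl n (s , i)
  rewrite crownLt-same n s i i | ≡ᵇ-suc-irreflˡ (toℕ i) | ≡ᵇ-suc-irreflʳ (toℕ i) = refl

crownLt-neg : ∀ n x y → crownLt n (negSigned x) (negSigned y) ≡ crownLt n x y
crownLt-neg n (true  , i) (true  , j) = refl
crownLt-neg n (true  , i) (false , j) = refl
crownLt-neg n (false , i) (true  , j) = refl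
crownLt-neg n (false , i) (false , j) = refl

crownLt⇒≤ : ∀ n x y → T (crownLt n x y) → T (_≤ᵇ_ (crown n) x y)
crownLt⇒≤ n x y x<y = from (T-∨ {does (x ≟± y)}) (inj₂ x<y)

soi-crown : ∀ n x y → soi (crown n) x y ≡ crownLt n x y
soi-crown n x y with x ≟± y
... | yes refl = sym (crownLt-irrefl n x)
... | no  _    = ∧-identityʳ _

crown-outdegree : ∀ n (i : Fin (2 * suc n)) →
                  Σ₂ (allSigned (2 * suc n)) (crownLt (suc n) (true , i)) ≡ false
crown-outdegree n i = begin
  Σ₂ (allSigned m) (crownLt (suc n) (true , i))
    ≡⟨ Σ₂-allSigned m (crownLt (suc n) (true , i)) ⟩
  Σ₂ (allFin m) (λ j → crownLt (suc n) (true , i) (true , j)) xor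
  Σ₂ (allFin m) (λ j → (k ≡ᵇ 0) ∧ (suc (toℕ j) ≡ᵇ m))
    ≡⟨ cong₂ _xor_ same-sign antipodal ⟩
  (k ≡ᵇ 0) xor (k ≡ᵇ 0)
    ≡⟨ xor-same (k ≡ᵇ 0) ⟩
  false ∎
  where
  m : ℕ
  m = 2 * suc n
  k : ℕ
  k = toℕ i

  same-sign : Σ₂ (allFin m) (λ j → crownLt (suc n) (true , i) (true , j)) ≡ (k ≡ᵇ 0)
  same-sign = begin
    Σ₂ (allFin m) (λ j → crownLt (suc n) (true , i) (true , j))
      ≡⟨ Σ₂-cong (allFin m) (crownLt-same (suc n) true i) ⟩
    Σ₂ (allFin m) (λ j → ((toℕ j ≡ᵇ suc k) xor (suc (toℕ j) ≡ᵇ k)) ∧ even k)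
      ≡⟨ Σ₂-∧ʳ (allFin m) (λ j → (toℕ j ≡ᵇ suc k) xor (suc (toℕ j) ≡ᵇ k)) (even k) ⟩
    Σ₂ (allFin m) (λ j → (toℕ j ≡ᵇ suc k) xor (suc (toℕ j) ≡ᵇ k)) ∧ even k
      ≡⟨ cong (_∧ even k) (Σ₂-xor (allFin m) (λ j → toℕ j ≡ᵇ suc k) (λ j → suc (toℕ j) ≡ᵇ k)) ⟩
    (Σ₂ (allFin m) (λ j → toℕ j ≡ᵇ suc k) xor Σ₂ (allFin m) (λ j → suc (toℕ j) ≡ᵇ k)) ∧ even k
      ≡⟨ cong (λ c → c ∧ even k)
           (cong₂ _xor_ (Σ₂-allFin-≡ᵇ m (suc k)) (Σ₂-allFin-suc≡ᵇ m k (<⇒≤ (toℕ<n i)))) ⟩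
    ((suc k <ᵇ m) xor (0 <ᵇ k)) ∧ even k
      ≡⟨ even-neighbours k (even-2* (suc n)) (toℕ<n i) ⟩
    (k ≡ᵇ 0) ∎

  antipodal : Σ₂ (allFin m) (λ j → (k ≡ᵇ 0) ∧ (suc (toℕ j) ≡ᵇ m)) ≡ (k ≡ᵇ 0)
  antipodal =
    trans (Σ₂-∧ˡ (allFin m) (k ≡ᵇ 0) (λ j → suc (toℕ j) ≡ᵇ m))
      (trans (cong ((k ≡ᵇ 0) ∧_) (Σ₂-allFin-suc≡ᵇ m m ≤-refl)) (∧-identityʳ (k ≡ᵇ 0)))

crown-indegree : ∀ n (y : SignedFin (2 * suc n)) →
  Σ₂ (allFin (2 * suc n)) (λ i → crownLt (suc n) (true , i) y) ≡ (suc (toℕ (proj₂ y)) ≡ᵇ 2 * suc n)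
crown-indegree n (true , j) = begin
  Σ₂ (allFin m) (λ i → crownLt (suc n) (true , i) (true , j))
    ≡⟨ Σ₂-cong (allFin m) (λ i → crownLt-same (suc n) true i j) ⟩
  Σ₂ (allFin m) (λ i → ((l ≡ᵇ suc (toℕ i)) xor (suc l ≡ᵇ toℕ i)) ∧ even (toℕ i))
    ≡⟨ Σ₂-cong (allFin m) (λ i →
         ∧-distribʳ-xor (even (toℕ i)) (l ≡ᵇ suc (toℕ i)) (suc l ≡ᵇ toℕ i)) ⟩
  Σ₂ (allFin m) (λ i → ((l ≡ᵇ suc (toℕ i)) ∧ even (toℕ i)) xor ((suc l ≡ᵇ toℕ i) ∧ even (toℕ i)))
    ≡⟨ Σ₂-xor (allFin m) (λ i → (l ≡ᵇ suc (toℕ i)) ∧ even (toℕ i))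
                         (λ i → (suc l ≡ᵇ toℕ i) ∧ even (toℕ i)) ⟩
  Σ₂ (allFin m) (λ i → (l ≡ᵇ suc (toℕ i)) ∧ even (toℕ i)) xor
  Σ₂ (allFin m) (λ i → (suc l ≡ᵇ toℕ i) ∧ even (toℕ i))
    ≡⟨ cong₂ _xor_ (Σ₂-allFin-pred m l even (<⇒≤ (toℕ<n j))) (Σ₂-allFin-≡ᵇ-∧ m (suc l) even) ⟩
  ((0 <ᵇ l) ∧ even (pred l)) xor ((suc l <ᵇ m) ∧ even (suc l))
    ≡⟨ odd-neighbours l (even-2* (suc n)) (toℕ<n j) ⟩
  (suc l ≡ᵇ m) ∎
  where
  m : ℕ
  m = 2 * suc n
  l : ℕ
  l = toℕ j
crown-indegree n (false , j) =
  trans (Σ₂-∧ʳ (allFin (2 * suc n)) (λ i → toℕ i ≡ᵇ 0) (suc (toℕ j) ≡ᵇ 2 * suc n))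
        (cong (_∧ (suc (toℕ j) ≡ᵇ 2 * suc n)) (Σ₂-allFin-≡ᵇ (2 * suc n) 0))

crown-coboundary-sum : ∀ n (α : Fin (2 * suc n) → Bool) (β : SignedFin (2 * suc n) → Bool) →
  Σ₂ (allFin (2 * suc n)) (λ i → Σ₂ (allSigned (2 * suc n)) (λ y →
    crownLt (suc n) (true , i) y ∧ (α i xor β y)))
  ≡ β (true , fromℕ (pred (2 * suc n))) xor β (false , fromℕ (pred (2 * suc n)))
crown-coboundary-sum n α β = begin
  Σ₂ (allFin m) (λ i → Σ₂ (allSigned m) (λ y → lt i y ∧ (α i xor β y)))
    ≡⟨ Σ₂-cong (allFin m) (λ i → Σ₂-∧-xor (allSigned m) (lt i) (λ _ → α i) β) ⟩
  Σ₂ (allFin m) (λ i →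
    Σ₂ (allSigned m) (λ y → lt i y ∧ α i) xor Σ₂ (allSigned m) (λ y → lt i y ∧ β y))
    ≡⟨ Σ₂-xor (allFin m) (λ i → Σ₂ (allSigned m) (λ y → lt i y ∧ α i))
                         (λ i → Σ₂ (allSigned m) (λ y → lt i y ∧ β y)) ⟩
  Σ₂ (allFin m) (λ i → Σ₂ (allSigned m) (λ y → lt i y ∧ α i)) xor
  Σ₂ (allFin m) (λ i → Σ₂ (allSigned m) (λ y → lt i y ∧ β y))
    ≡⟨ cong₂ _xor_ lower-vanishes (Σ₂-comm (allFin m) (allSigned m) (λ i y → lt i y ∧ β y)) ⟩
  Σ₂ (allSigned m) (λ y → Σ₂ (allFin m) (λ i → lt i y ∧ β y))
    ≡⟨ Σ₂-cong (allSigned m) upper-degree ⟩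
  Σ₂ (allSigned m) (λ y → (suc (toℕ (proj₂ y)) ≡ᵇ m) ∧ β y)
    ≡⟨ Σ₂-allSigned m (λ y → (suc (toℕ (proj₂ y)) ≡ᵇ m) ∧ β y) ⟩
  Σ₂ (allFin m) (λ j → (suc (toℕ j) ≡ᵇ m) ∧ β (true , j)) xor
  Σ₂ (allFin m) (λ j → (suc (toℕ j) ≡ᵇ m) ∧ β (false , j))
    ≡⟨ cong₂ _xor_ (Σ₂-allFin-last (pred m) (λ j → β (true , j)))
                   (Σ₂-allFin-last (pred m) (λ j → β (false , j))) ⟩
  β (true , fromℕ (pred m)) xor β (false , fromℕ (pred m)) ∎
  where
  m : ℕ
  m = 2 * suc n

  lt : Fin m → SignedFin m → Bool
  lt i = crownLt (suc n) (true , i)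

  lower-vanishes : Σ₂ (allFin m) (λ i → Σ₂ (allSigned m) (λ y → lt i y ∧ α i)) ≡ false
  lower-vanishes =
    trans (Σ₂-cong (allFin m) (λ i → trans (Σ₂-∧ʳ (allSigned m) (lt i) (α i))
                                            (cong (_∧ α i) (crown-outdegree n i))))
          (Σ₂-false (allFin m))

  upper-degree : ∀ y → Σ₂ (allFin m) (λ i → lt i y ∧ β y) ≡ (suc (toℕ (proj₂ y)) ≡ᵇ m) ∧ β y
  upper-degree y =
    trans (Σ₂-∧ʳ (allFin m) (λ i → lt i y) (β y)) (cong (_∧ β y) (crown-indegree n y))

hits : Carrier Q₁ → Carrier Q₁ → Carrier Q₁ → Carrier Q₁ → Bool
hits a b p q = does (p ≟± a) ∧ does (q ≟± b)

level : Carrier Q₁ → Bool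
level (_ , i) = toℕ i ≡ᵇ 1

-- The α and β of the coboundary decomposition.
lowerWeight : Carrier Q₁ → Carrier Q₁ → Carrier Q₁ → Bool
lowerWeight a b p =
  if does (a ≟± b) then level a ∧ level p
  else if does (proj₁ a Bool.≟ proj₁ b) then level p xor proj₁ p
  else proj₁ p

upperWeight : Carrier Q₁ → Carrier Q₁ → Carrier Q₁ → Bool
upperWeight a b q =
  if does (a ≟± b) then not (level a) ∧ not (level q)
  else if does (proj₁ a Bool.≟ proj₁ b) then level q xor proj₁ q
  else proj₁ q

∀-Bool? : {P : Bool → Set} → Dec (P true) → Dec (P false) → Dec (∀ s → P s)
∀-Bool? t? f? = map′ (λ (t , f) → λ { true → t ; false → f }) (λ h → h true , h false) (t? ×-dec f?)

∀-Q₁? : {P : Carrier Q₁ → Set} → Decidable P → Dec (∀ p → P p)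
∀-Q₁? P? = map′ (λ h p → h (proj₁ p) (proj₂ p)) (λ h s i → h (s , i))
                (∀-Bool? (all? (λ i → P? (true , i))) (all? (λ i → P? (false , i))))

Q₁-orbit-coboundary : ∀ a b p q → T (_≤ᵇ_ Q₁ a b) → T (_≤ᵇ_ Q₁ p q) →
  hits a b p q xor hits a b (negSigned p) (negSigned q) ≡ lowerWeight a b p xor upperWeight a b q
Q₁-orbit-coboundary = from-yes
  (∀-Q₁? λ a → ∀-Q₁? λ b → ∀-Q₁? λ p → ∀-Q₁? λ q →
    T? (_≤ᵇ_ Q₁ a b) →-dec (T? (_≤ᵇ_ Q₁ p q) →-dec
      ((hits a b p q xor hits a b (negSigned p) (negSigned q))
         Bool.≟ (lowerWeight a b p xor upperWeight a b q))))

upperWeight-antipodal : ∀ a b q → T (_≤ᵇ_ Q₁ a b) →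
  upperWeight a b q xor upperWeight a b (negSigned q) ≡ soi Q₁ a b
upperWeight-antipodal = from-yes
  (∀-Q₁? λ a → ∀-Q₁? λ b → ∀-Q₁? λ q →
    T? (_≤ᵇ_ Q₁ a b) →-dec
      ((upperWeight a b q xor upperWeight a b (negSigned q)) Bool.≟ soi Q₁ a b))

Z₂-map-orbit-coboundary : ∀ {P} {f : Carrier P → Carrier Q₁} → IsZ2Map P Q₁ f →
  ∀ {a b} → T (_≤ᵇ_ Q₁ a b) → ∀ x y → T (_≤ᵇ_ P x y) →
  hits a b (f x) (f y) xor hits a b (f (neg P x)) (f (neg P y)) ≡
  lowerWeight a b (f x) xor upperWeight a b (f y)
Z₂-map-orbit-coboundary {P} {f} f-z2 {a} {b} a≤b x y x≤y = begin
  hits a b (f x) (f y) xor hits a b (f (neg P x)) (f (neg P y))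
    ≡⟨ cong₂ (λ p q → hits a b (f x) (f y) xor hits a b p q) (equivar x) (equivar y) ⟩
  hits a b (f x) (f y) xor hits a b (negSigned (f x)) (negSigned (f y))
    ≡⟨ Q₁-orbit-coboundary a b (f x) (f y) a≤b (monotone x y x≤y) ⟩
  lowerWeight a b (f x) xor upperWeight a b (f y) ∎
  where open IsZ2Map f-z2

lemma4 : (n : ℕ) → n ≥ 1 → (f : Carrier (crown n) → Carrier Q₁) →
         IsZ2Map (crown n) Q₁ f →
         _≈₂_ {Q₁} (hat (crown n) Q₁ f (soi (crown n))) (soi Q₁)
lemma4 (suc n) _ f f-z2 a b a≤b = begin
  hat (crown (suc n)) Q₁ f (soi (crown (suc n))) a b
    ≡⟨ hat-soi (crown (suc n)) Q₁ f a b ⟩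
  Σ₂ (allSigned m) (λ x → Σ₂ (allSigned m) (λ y → soi (crown (suc n)) x y ∧ w x y))
    ≡⟨ Σ₂-cong (allSigned m) (λ x → Σ₂-cong (allSigned m) (λ y →
         cong (_∧ w x y) (soi-crown (suc n) x y))) ⟩
  Σ₂ (allSigned m) (λ x → Σ₂ (allSigned m) (λ y → crownLt (suc n) x y ∧ w x y))
    ≡⟨ Σ₂-allSigned-fold m (crownLt (suc n)) w (crownLt-neg (suc n)) ⟩
  Σ₂ (allFin m) (λ i → Σ₂ (allSigned m) (λ y →
    crownLt (suc n) (true , i) y ∧ (w (true , i) y xor w (false , i) (negSigned y))))
    ≡⟨ Σ₂-cong (allFin m) (λ i → Σ₂-cong (allSigned m) (λ y →
         ∧-congˡ-T (crownLt (suc n) (true , i) y) (λ x<y →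
           Z₂-map-orbit-coboundary f-z2 a≤b (true , i) y (crownLt⇒≤ (suc n) (true , i) y x<y)))) ⟩
  Σ₂ (allFin m) (λ i → Σ₂ (allSigned m) (λ y →
    crownLt (suc n) (true , i) y ∧ (lowerWeight a b (f (true , i)) xor upperWeight a b (f y))))
    ≡⟨ crown-coboundary-sum n (λ i → lowerWeight a b (f (true , i))) (upperWeight a b ∘ f) ⟩
  upperWeight a b (f (true , top)) xor upperWeight a b (f (false , top))
    ≡⟨ cong (λ q → upperWeight a b (f (true , top)) xor upperWeight a b q)
            (IsZ2Map.equivar f-z2 (true , top)) ⟩
  upperWeight a b (f (true , top)) xor upperWeight a b (negSigned (f (true , top)))
    ≡⟨ upperWeight-antipodal a b (f (true , top)) a≤b ⟩
  soi Q₁ a b ∎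
  where
  m : ℕ
  m = 2 * suc n

  top : Fin m
  top = fromℕ (pred m)

  w : SignedFin m → SignedFin m → Bool
  w x y = hits a b (f x) (f y)
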